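{- For every $n\ge2$: $|A_n|=|\mathcal{S}_{n-1}|$, $|B_n|=|\mathcal{S}_{n-1}|$, and $|C_n|=|B_{n-1}|+|C_{n-1}|$.
   Context: A Dyck path of length $2N$ is a sequence of $2N$ steps $(1,1)$ (up) or $(1,-1)$ (down) from $(0,0)$ to $(2N,0)$ staying in $\{y\ge0\}$. A valley is a point where a down step is followed by an up step; the path is nondecreasing if the altitudes of its valleys, left to right, are nondecreasing. Cutting at the valleys writes the path as consecutive mountains with magnitudes $(d_1,e_1),\dots,(d_k,e_k)$, where $(d_i,e_i)$ are the numbers of up and down steps of the $i$-th mountain; a nondecreasing Dyck path is determined by this sequence. Let $\mathcal{S}_N$ be the set of nondecreasing Dyck paths of length $2N$. Define subsets of $\mathcal{S}_N$: $A_N$ = paths whose last mountain has $d_k\ge2$; $B_N$ = paths with at least two mountains whose last two mountains satisfy $d_{k-1}=e_{k-1}$ and $d_k=1$; $C_N$ = paths with at least two mountains whose last two mountains satisfy $d_{k-1}>e_{k-1}$ and $d_k=1$. -}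

module Defs where

open import Data.Bool using (Bool; true; false; _∧_; _∨_; if_then_else_)
open import Data.Nat using (ℕ; zero; suc; _*_; _≡ᵇ_; _≤ᵇ_)
open import Data.Product using (_×_; _,_)
open import Data.List using (List; []; _∷_; _++_; map; length; filterᵇ; reverse)

-- A step: true = up step (1,1), false = down step (1,-1).
Step : Set
Step = Bool

up down : Step
up = true
down = false

Path : Set
Path = List Step

allPaths : ℕ → List Path
allPaths zero    = [] ∷ []
allPaths (suc m) = map (up ∷_) (allPaths m) ++ map (down ∷_) (allPaths m)

dyckFrom : ℕ → Path → Bool
dyckFrom h       []            = h ≡ᵇ 0
dyckFrom h       (true  ∷ s)   = dyckFrom (suc h) s
dyckFrom zero    (false ∷ s)   = false
dyckFrom (suc h) (false ∷ s)   = dyckFrom h s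

isDyck : Path → Bool
isDyck = dyckFrom 0

-- Altitudes of the valleys (a down step followed by an up step), left to right,
-- for a path started at altitude h.
valleysFrom : ℕ → Path → List ℕ
valleysFrom h []                    = []
valleysFrom h (true ∷ s)            = valleysFrom (suc h) s
valleysFrom zero (false ∷ s)        = valleysFrom zero s   -- irrelevant for Dyck paths
valleysFrom (suc h) (false ∷ true ∷ s)  = h ∷ valleysFrom h (true ∷ s)
valleysFrom (suc h) (false ∷ false ∷ s) = valleysFrom h (false ∷ s)
valleysFrom (suc h) (false ∷ [])        = []

valleys : Path → List ℕ
valleys = valleysFrom 0

nondecreasingᵇ : List ℕ → Bool
nondecreasingᵇ []           = true
nondecreasingᵇ (x ∷ [])     = true
nondecreasingᵇ (x ∷ y ∷ xs) = (x ≤ᵇ y) ∧ nondecreasingᵇ (y ∷ xs)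

inS : ℕ → Path → Bool
inS N p = (length p ≡ᵇ 2 * N) ∧ isDyck p ∧ nondecreasingᵇ (valleys p)

runs : Path → List (Step × ℕ)
runs [] = []
runs (x ∷ xs) with runs xs
... | []              = (x , 1) ∷ []
... | (y , k) ∷ r     = if (x ∧ y) ∨ (Data.Bool.not x ∧ Data.Bool.not y)
                          then (y , suc k) ∷ r
                          else (x , 1) ∷ (y , k) ∷ r

-- Pair up-runs with the following down-runs: the mountain magnitudes (d_i, e_i)
-- obtained by cutting the path at its valleys.
pairRuns : List (Step × ℕ) → List (ℕ × ℕ)
pairRuns ((true , d) ∷ (false , e) ∷ r) = (d , e) ∷ pairRuns r
pairRuns _ = []

mountains : Path → List (ℕ × ℕ)
mountains p = pairRuns (runs p)

-- last mountain has d_k ≥ 2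
lastTwoᵇ-A : List (ℕ × ℕ) → Bool
lastTwoᵇ-A ((d , e) ∷ _) = 2 ≤ᵇ d
lastTwoᵇ-A []            = false

-- (reversed list) at least two mountains, d_{k-1} = e_{k-1}, d_k = 1
lastTwoᵇ-B : List (ℕ × ℕ) → Bool
lastTwoᵇ-B ((dk , ek) ∷ (d , e) ∷ _) = (d ≡ᵇ e) ∧ (dk ≡ᵇ 1)
lastTwoᵇ-B _ = false

-- (reversed list) at least two mountains, d_{k-1} > e_{k-1}, d_k = 1
lastTwoᵇ-C : List (ℕ × ℕ) → Bool
lastTwoᵇ-C ((dk , ek) ∷ (d , e) ∷ _) = (suc e ≤ᵇ d) ∧ (dk ≡ᵇ 1)
lastTwoᵇ-C _ = false

inA inB inC : ℕ → Path → Bool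
inA N p = inS N p ∧ lastTwoᵇ-A (reverse (mountains p))
inB N p = inS N p ∧ lastTwoᵇ-B (reverse (mountains p))
inC N p = inS N p ∧ lastTwoᵇ-C (reverse (mountains p))

card : (ℕ → Path → Bool) → ℕ → ℕ
card X N = length (filterᵇ (X N) (allPaths (2 * N)))

∣S∣ ∣A∣ ∣B∣ ∣C∣ : ℕ → ℕ
∣S∣ = card inS
∣A∣ = card inA
∣B∣ = card inB
∣C∣ = card inC

-- A nondecreasing Dyck path is determined by its mountains (d₁ , e₁) … (d_k , e_k): every mountain
-- but the last one rises (eᵢ ≤ dᵢ), the last one descends to the ground, e_k = d_k + Σ_{i<k} (dᵢ − eᵢ),
-- and the semilength is Σ dᵢ. Reading the mountains from the end, each identity is a bijection:
-- removing the peak of the last mountain maps A_n onto S_{n-1}; merging the last two mountains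
-- (a , a) (1 , _) into one mountain of height a maps B_n onto S_{n-1}; lowering the penultimate
-- peak, (a , b) (1 , _) ↦ (a − 1 , b) (1 , _), maps C_n onto B_{n-1} ⊎ C_{n-1}, according as
-- b = a − 1 or b < a − 1.
module Submission where

open import Defs
open import Data.Bool using (Bool; true; false; T; not; _∧_; _∨_)
open import Data.Bool.Properties using (T-∧; T-∨; T-irrelevant; ∧-identityʳ; ∧-zeroʳ)
open import Data.Empty using (⊥; ⊥-elim)
open import Data.Fin using (Fin; zero)
open import Data.Fin.Permutation using (↔⇒≡)
open import Data.Fin.Properties using (+↔⊎)
open import Data.List using (List; []; _∷_; _++_; replicate; map; reverse; length; filterᵇ)
open import Data.List.Properties
  using (∷-injective; ++-assoc; ++-identityʳ; filter-++; length-++; length-replicate;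
         reverse-map; reverse-involutive; unfold-reverse)
open import Data.List.Relation.Binary.Permutation.Propositional using (↭-sym)
open import Data.List.Relation.Binary.Permutation.Propositional.Properties using (↭-reverse; All-resp-↭)
open import Data.List.Relation.Unary.All as All using (All; []; _∷_)
open import Data.Nat using (ℕ; zero; suc; pred; _+_; _*_; _∸_; _≤_; _<_; z≤n; s≤s; _≤?_; _≡ᵇ_; _≤ᵇ_)
open import Data.Nat.ListAction using (sum)
open import Data.Nat.ListAction.Properties using (sum-↭)
open import Data.Nat.Properties
open import Data.Nat.Tactic.RingSolver using (solve-∀)
open import Data.Product using (Σ; _×_; _,_; proj₁; proj₂; uncurry)
open import Data.Sum as Sum using (_⊎_; inj₁; inj₂; [_,_])
open import Data.Sum.Function.Propositional using (_⊎-↔_)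
open import Data.Unit using (⊤; tt)
open import Function using (_∘_; const; case_of_)
open import Function.Bundles using (_↔_; mk↔ₛ′; _⇔_; mk⇔; Equivalence)
open import Function.Properties.Inverse using (↔-trans; ↔-sym)
import Function.Properties.Equivalence as ⇔
open import Relation.Binary.PropositionalEquality
  using (_≡_; refl; sym; trans; cong; cong₂; subst; module ≡-Reasoning)
open import Relation.Nullary using (yes; no; ¬_)
open import Relation.Nullary.Decidable using (T?)

-- Counting through bijections

Paths : (Path → Bool) → ℕ → Set
Paths P m = Σ Path λ p → length p ≡ m × T (P p)

Paths-≡ : ∀ {P m p q} {lp : length p ≡ m} {lq : length q ≡ m} {tp : T (P p)} {tq : T (P q)} →
          p ≡ q → _≡_ {A = Paths P m} (p , lp , tp) (q , lq , tq)
Paths-≡ {lp = lp} {lq} {tp} {tq} refl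
  rewrite ≡-irrelevant lp lq | T-irrelevant tp tq = refl

count : (Path → Bool) → ℕ → ℕ
count P m = length (filterᵇ P (allPaths m))

length-filterᵇ-map : ∀ {A B : Set} (P : B → Bool) (f : A → B) xs →
                     length (filterᵇ P (map f xs)) ≡ length (filterᵇ (P ∘ f) xs)
length-filterᵇ-map P f [] = refl
length-filterᵇ-map P f (x ∷ xs) with P (f x)
... | true  = cong suc (length-filterᵇ-map P f xs)
... | false = length-filterᵇ-map P f xs

count-suc : ∀ P m → count P (suc m) ≡ count (P ∘ (up ∷_)) m + count (P ∘ (down ∷_)) m
count-suc P m = begin
  length (filterᵇ P (ups ++ downs))
    ≡⟨ cong length (filter-++ (T? ∘ P) ups downs) ⟩
  length (filterᵇ P ups ++ filterᵇ P downs)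
    ≡⟨ length-++ (filterᵇ P ups) ⟩
  length (filterᵇ P ups) + length (filterᵇ P downs)
    ≡⟨ cong₂ _+_ (length-filterᵇ-map P (up ∷_) (allPaths m)) (length-filterᵇ-map P (down ∷_) (allPaths m)) ⟩
  count (P ∘ (up ∷_)) m + count (P ∘ (down ∷_)) m ∎
  where
  open ≡-Reasoning
  ups downs : List Path
  ups   = map (up ∷_) (allPaths m)
  downs = map (down ∷_) (allPaths m)

Paths-suc↔ : ∀ P m → (Paths (P ∘ (up ∷_)) m ⊎ Paths (P ∘ (down ∷_)) m) ↔ Paths P (suc m)
Paths-suc↔ P m = mk↔ₛ′ to from to-from from-to
  where
  to : _ → Paths P (suc m)
  to (inj₁ (p , lp , t)) = up ∷ p , cong suc lp , t
  to (inj₂ (p , lp , t)) = down ∷ p , cong suc lp , t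
  from : Paths P (suc m) → _
  from (true  ∷ p , lp , t) = inj₁ (p , cong pred lp , t)
  from (false ∷ p , lp , t) = inj₂ (p , cong pred lp , t)
  to-from : ∀ x → to (from x) ≡ x
  to-from (true  ∷ p , _) = Paths-≡ refl
  to-from (false ∷ p , _) = Paths-≡ refl
  from-to : ∀ x → from (to x) ≡ x
  from-to (inj₁ _) = cong inj₁ (Paths-≡ refl)
  from-to (inj₂ _) = cong inj₂ (Paths-≡ refl)

Fin-count↔Paths : ∀ P m → Fin (count P m) ↔ Paths P m
Fin-count↔Paths P zero with P [] in eq
... | true  = mk↔ₛ′ (λ _ → [] , refl , subst T (sym eq) _) (λ _ → zero)
                    (λ { ([] , refl , _) → Paths-≡ refl }) (λ { zero → refl })
... | false = mk↔ₛ′ (λ ()) (λ { ([] , refl , t) → ⊥-elim (subst T eq t) })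
                    (λ { ([] , refl , t) → ⊥-elim (subst T eq t) }) (λ ())
Fin-count↔Paths P (suc m) rewrite count-suc P m =
  ↔-trans +↔⊎ (↔-trans (Fin-count↔Paths _ m ⊎-↔ Fin-count↔Paths _ m) (Paths-suc↔ P m))

count-cong : ∀ {P Q m n} → Paths P m ↔ Paths Q n → count P m ≡ count Q n
count-cong {P} {Q} {m} {n} iso =
  ↔⇒≡ (↔-trans (Fin-count↔Paths P m) (↔-trans iso (↔-sym (Fin-count↔Paths Q n))))

count-cong-⊎ : ∀ {P Q R m n o} → Paths P m ↔ (Paths Q n ⊎ Paths R o) → count P m ≡ count Q n + count R o
count-cong-⊎ {P} {Q} {R} {m} {n} {o} iso =
  ↔⇒≡ (↔-trans (Fin-count↔Paths P m)
        (↔-trans iso (↔-sym (↔-trans +↔⊎ (Fin-count↔Paths Q n ⊎-↔ Fin-count↔Paths R o)))))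

T-∧-false : ∀ x → ¬ T (x ∧ false)
T-∧-false x = subst T (∧-zeroʳ x)

T-∨-irrelevant : ∀ {x y} → (T x → T y → ⊥) → (u v : T x ⊎ T y) → u ≡ v
T-∨-irrelevant _    (inj₁ u) (inj₁ v) = cong inj₁ (T-irrelevant u v)
T-∨-irrelevant _    (inj₂ u) (inj₂ v) = cong inj₂ (T-irrelevant u v)
T-∨-irrelevant disj (inj₁ u) (inj₂ v) = ⊥-elim (disj u v)
T-∨-irrelevant disj (inj₂ u) (inj₁ v) = ⊥-elim (disj v u)

Σ-T-∨↔⊎ : ∀ {A : Set} (Q R : A → Bool) → (∀ x → T (Q x) → T (R x) → ⊥) →
  Σ A (λ x → T (Q x ∨ R x)) ↔ (Σ A (T ∘ Q) ⊎ Σ A (T ∘ R))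
Σ-T-∨↔⊎ {A} Q R disj = mk↔ₛ′ to from to∘from from∘to
  where
  to : Σ A (λ x → T (Q x ∨ R x)) → Σ A (T ∘ Q) ⊎ Σ A (T ∘ R)
  to (x , t) = Sum.map (x ,_) (x ,_) (Equivalence.to T-∨ t)
  from : Σ A (T ∘ Q) ⊎ Σ A (T ∘ R) → Σ A (λ x → T (Q x ∨ R x))
  from (inj₁ (x , q)) = x , Equivalence.from T-∨ (inj₁ q)
  from (inj₂ (x , r)) = x , Equivalence.from T-∨ (inj₂ r)
  T-∨-inverse : ∀ x (u : T (Q x) ⊎ T (R x)) → Equivalence.to T-∨ (Equivalence.from (T-∨ {Q x} {R x}) u) ≡ u
  T-∨-inverse x u = T-∨-irrelevant (disj x) _ u
  to∘from : ∀ y → to (from y) ≡ y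
  to∘from (inj₁ (x , q)) = cong (Sum.map (x ,_) (x ,_)) (T-∨-inverse x (inj₁ q))
  to∘from (inj₂ (x , r)) = cong (Sum.map (x ,_) (x ,_)) (T-∨-inverse x (inj₂ r))
  from∘to : ∀ x → from (to x) ≡ x
  from∘to (x , t) with Equivalence.to (T-∨ {Q x} {R x}) t
  ... | inj₁ q = cong (x ,_) (T-irrelevant (Equivalence.from T-∨ (inj₁ q)) t)
  ... | inj₂ r = cong (x ,_) (T-irrelevant (Equivalence.from T-∨ (inj₂ r)) t)

Mountain : Set
Mountain = ℕ × ℕ

IsMountain : Mountain → Set
IsMountain (d , e) = 1 ≤ d × 1 ≤ e

fromMountains : List Mountain → Path
fromMountains [] = []
fromMountains ((d , e) ∷ ms) = replicate d up ++ replicate e down ++ fromMountains ms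

mountainRuns : List Mountain → List (Step × ℕ)
mountainRuns [] = []
mountainRuns ((d , e) ∷ ms) = (up , d) ∷ (down , e) ∷ mountainRuns ms

FirstRunNot : Step → List (Step × ℕ) → Set
FirstRunNot b [] = ⊤
FirstRunNot b ((c , _) ∷ _) = c ≡ not b

runs-replicate : ∀ b k r → FirstRunNot b (runs r) →
                 runs (replicate (suc k) b ++ r) ≡ (b , suc k) ∷ runs r
runs-replicate b zero r h with runs r
runs-replicate b     zero r h    | [] = refl
runs-replicate true  zero r refl | (_ , _) ∷ _ = refl
runs-replicate false zero r refl | (_ , _) ∷ _ = refl
runs-replicate true  (suc k) r h rewrite runs-replicate true  k r h = refl
runs-replicate false (suc k) r h rewrite runs-replicate false k r h = refl

runs-fromMountains : ∀ {ms} → All IsMountain ms → runs (fromMountains ms) ≡ mountainRuns ms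
runs-fromMountains [] = refl
runs-fromMountains {(suc d , suc e) ∷ ms} ((s≤s _ , s≤s _) ∷ pos) =
  trans (runs-replicate up d _ (subst (FirstRunNot up) (sym descent) refl))
        (cong ((up , suc d) ∷_) descent)
  where
  rest : runs (fromMountains ms) ≡ mountainRuns ms
  rest = runs-fromMountains pos
  firstRun : ∀ ms → FirstRunNot down (mountainRuns ms)
  firstRun []      = tt
  firstRun (_ ∷ _) = refl
  descent : runs (replicate (suc e) down ++ fromMountains ms) ≡ (down , suc e) ∷ mountainRuns ms
  descent = trans (runs-replicate down e _ (subst (FirstRunNot down) (sym rest) (firstRun ms)))
                  (cong ((down , suc e) ∷_) rest)

pairRuns-mountainRuns : ∀ ms → pairRuns (mountainRuns ms) ≡ ms
pairRuns-mountainRuns [] = refl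
pairRuns-mountainRuns (m ∷ ms) = cong (m ∷_) (pairRuns-mountainRuns ms)

mountains-fromMountains : ∀ {ms} → All IsMountain ms → mountains (fromMountains ms) ≡ ms
mountains-fromMountains {ms} pos =
  trans (cong pairRuns (runs-fromMountains pos)) (pairRuns-mountainRuns ms)

Decomposition : Path → Set
Decomposition p = Σ ℕ λ a → Σ (List Mountain) λ ms → Σ ℕ λ b →
  All IsMountain ms × p ≡ replicate a down ++ fromMountains ms ++ replicate b up

decompose : ∀ p → Decomposition p
decompose [] = 0 , [] , 0 , [] , refl
decompose (false ∷ p) with decompose p
... | a , ms , b , pos , eq = suc a , ms , b , pos , cong (down ∷_) eq
decompose (true ∷ p) with decompose p
... | suc a , ms , b , pos , eq =
  0 , (1 , suc a) ∷ ms , b , (s≤s z≤n , s≤s z≤n) ∷ pos ,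
  cong (up ∷_) (trans eq (sym (++-assoc (replicate (suc a) down) (fromMountains ms) (replicate b up))))
... | zero , [] , b , pos , eq = 0 , [] , suc b , [] , cong (up ∷_) eq
... | zero , (d , e) ∷ ms , b , (_ , e≥1) ∷ pos , eq =
  0 , (suc d , e) ∷ ms , b , (s≤s z≤n , e≥1) ∷ pos , cong (up ∷_) eq

dyckFrom-endsUp : ∀ h q b → dyckFrom h (q ++ replicate (suc b) up) ≡ false
dyckFrom-endsUp h [] b = endsHigh h b
  where
  endsHigh : ∀ h b → dyckFrom (suc h) (replicate b up) ≡ false
  endsHigh h zero    = refl
  endsHigh h (suc b) = endsHigh (suc h) b
dyckFrom-endsUp h       (true  ∷ q) b = dyckFrom-endsUp (suc h) q b
dyckFrom-endsUp zero    (false ∷ q) b = refl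
dyckFrom-endsUp (suc h) (false ∷ q) b = dyckFrom-endsUp h q b

dyck⇒fromMountains : ∀ p → T (isDyck p) → Σ (List Mountain) λ ms → All IsMountain ms × p ≡ fromMountains ms
dyck⇒fromMountains p dyck with decompose p
... | suc a , ms , b , pos , refl = ⊥-elim dyck
... | zero , ms , suc b , pos , refl rewrite dyckFrom-endsUp 0 (fromMountains ms) b = ⊥-elim dyck
... | zero , ms , zero , pos , eq = ms , pos , trans eq (++-identityʳ (fromMountains ms))

-- Nondecreasing Dyck paths as admissible mountain sequences

dyckFrom-ups : ∀ d h X → dyckFrom h (replicate d up ++ X) ≡ dyckFrom (d + h) X
dyckFrom-ups zero    h X = refl
dyckFrom-ups (suc d) h X = trans (dyckFrom-ups d (suc h) X) (cong (λ k → dyckFrom k X) (+-suc d h))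

valleysFrom-ups : ∀ d h X → valleysFrom h (replicate d up ++ X) ≡ valleysFrom (d + h) X
valleysFrom-ups zero    h X = refl
valleysFrom-ups (suc d) h X = trans (valleysFrom-ups d (suc h) X) (cong (λ k → valleysFrom k X) (+-suc d h))

dyckFrom-downs : ∀ {e H} X → e ≤ H → dyckFrom H (replicate e down ++ X) ≡ dyckFrom (H ∸ e) X
dyckFrom-downs X z≤n     = refl
dyckFrom-downs X (s≤s e≤H) = dyckFrom-downs X e≤H

dyckFrom-tooManyDowns : ∀ {e H} X → H < e → dyckFrom H (replicate e down ++ X) ≡ false
dyckFrom-tooManyDowns {suc e} {zero}  X _         = refl
dyckFrom-tooManyDowns {suc e} {suc H} X (s≤s H<e) = dyckFrom-tooManyDowns X H<e

valleysFrom-downs-up : ∀ {e H} X → e ≤ H →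
  valleysFrom (suc H) (replicate (suc e) down ++ up ∷ X) ≡ (H ∸ e) ∷ valleysFrom (H ∸ e) (up ∷ X)
valleysFrom-downs-up X z≤n = refl
valleysFrom-downs-up X (s≤s e≤H) = valleysFrom-downs-up X e≤H

valleysFrom-downs : ∀ e H → valleysFrom H (replicate e down) ≡ []
valleysFrom-downs zero          H       = refl
valleysFrom-downs (suc zero)    zero    = refl
valleysFrom-downs (suc zero)    (suc H) = refl
valleysFrom-downs (suc (suc e)) zero    = valleysFrom-downs (suc e) zero
valleysFrom-downs (suc (suc e)) (suc H) = valleysFrom-downs (suc e) H

-- Putting h in front of the valleys also forces them to stay at least h.
nondecreasingDyckFrom : ℕ → Path → Bool
nondecreasingDyckFrom h p = dyckFrom h p ∧ nondecreasingᵇ (h ∷ valleysFrom h p)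

-- The same condition read on the mountain sequence; h is the altitude of the current valley.
data Admissible : ℕ → List Mountain → Set where
  last : ∀ {h d e} → e ≡ d + h → Admissible h ((d , e) ∷ [])
  _∷_  : ∀ {h d e ms} → e ≤ d → Admissible (d + h ∸ e) ms → Admissible h ((d , e) ∷ ms)

valley≥⇔rising : ∀ {d e} h → e ≤ d + h → h ≤ d + h ∸ e ⇔ e ≤ d
valley≥⇔rising {d} {e} h e≤d+h = mk⇔
  (λ h≤ → ∸-cancelʳ-≤ e≤d+h (subst (_≤ d + h ∸ e) (sym (m+n∸m≡n d h)) h≤))
  (λ e≤d → subst (_≤ d + h ∸ e) (m+n∸m≡n d h) (∸-monoʳ-≤ (d + h) e≤d))

nondecreasingDyckFrom-ascent : ∀ h d e X →
  nondecreasingDyckFrom h (replicate d up ++ replicate e down ++ X)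
  ≡ dyckFrom (d + h) (replicate e down ++ X) ∧ nondecreasingᵇ (h ∷ valleysFrom (d + h) (replicate e down ++ X))
nondecreasingDyckFrom-ascent h d e X =
  cong₂ (λ b vs → b ∧ nondecreasingᵇ (h ∷ vs)) (dyckFrom-ups d h _) (valleysFrom-ups d h _)

nondecreasingDyckFrom-tooManyDowns : ∀ h d e X → d + h < e →
  nondecreasingDyckFrom h (replicate (suc d) up ++ replicate (suc e) down ++ X) ≡ false
nondecreasingDyckFrom-tooManyDowns h d e X d+h<e =
  trans (nondecreasingDyckFrom-ascent h (suc d) (suc e) X)
        (cong (_∧ nondecreasingᵇ (h ∷ valleysFrom (suc d + h) (replicate (suc e) down ++ X)))
              (dyckFrom-tooManyDowns X (s≤s d+h<e)))

nondecreasingDyckFrom-lastMountain : ∀ h d e →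
  T (nondecreasingDyckFrom h (fromMountains ((suc d , suc e) ∷ []))) ⇔ e ≡ d + h
nondecreasingDyckFrom-lastMountain h d e with e ≤? d + h
... | no e≰d+h = mk⇔
  (⊥-elim ∘ subst T (nondecreasingDyckFrom-tooManyDowns h d e [] (≰⇒> e≰d+h)))
  (⊥-elim ∘ e≰d+h ∘ ≤-reflexive)
... | yes e≤d+h = mk⇔
  (λ t → sym (∸-cancelʳ-≡ e≤d+h ≤-refl
                (trans (≡ᵇ⇒≡ (d + h ∸ e) 0 (proj₁ (Equivalence.to T-∧ (subst T final t)))) (sym (n∸n≡0 e)))))
  (λ e≡d+h → subst T (sym final)
                (Equivalence.from T-∧ (≡⇒≡ᵇ (d + h ∸ e) 0 (trans (cong (_∸ e) (sym e≡d+h)) (n∸n≡0 e)) , tt)))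
  where
  final : nondecreasingDyckFrom h (fromMountains ((suc d , suc e) ∷ [])) ≡ (d + h ∸ e ≡ᵇ 0) ∧ true
  final = trans (nondecreasingDyckFrom-ascent h (suc d) (suc e) [])
    (cong₂ (λ b vs → b ∧ nondecreasingᵇ (h ∷ vs))
           (dyckFrom-downs [] (s≤s e≤d+h))
           (trans (cong (valleysFrom (suc d + h)) (++-identityʳ (replicate (suc e) down)))
                  (valleysFrom-downs (suc e) (suc d + h))))

-- The valley after the mountain is at altitude d + h ∸ e, which must not lie below h.
nondecreasingDyckFrom-mountain : ∀ h d e X →
  T (nondecreasingDyckFrom h (replicate (suc d) up ++ replicate (suc e) down ++ up ∷ X))
  ⇔ (e ≤ d × T (nondecreasingDyckFrom (d + h ∸ e) (up ∷ X)))
nondecreasingDyckFrom-mountain h d e X with e ≤? d + h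
... | no e≰d+h = mk⇔
  (⊥-elim ∘ subst T (nondecreasingDyckFrom-tooManyDowns h d e (up ∷ X) (≰⇒> e≰d+h)))
  (λ (e≤d , _) → ⊥-elim (e≰d+h (≤-trans e≤d (m≤m+n d h))))
... | yes e≤d+h = mk⇔
  (λ t → let (ta , tbc) = Equivalence.to (T-∧ {a}) (subst T step t)
             (tb , tc)  = Equivalence.to (T-∧ {b}) tbc
         in Equivalence.to (valley≥⇔rising h e≤d+h) (≤ᵇ⇒≤ h k tb) , Equivalence.from (T-∧ {a}) (ta , tc))
  (λ (e≤d , tac) →
     let (ta , tc) = Equivalence.to (T-∧ {a}) tac
     in subst T (sym step) (Equivalence.from (T-∧ {a})
          (ta , Equivalence.from (T-∧ {b}) (≤⇒≤ᵇ (Equivalence.from (valley≥⇔rising h e≤d+h) e≤d) , tc))))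
  where
  k : ℕ
  k = d + h ∸ e
  a b c : Bool
  a = dyckFrom k (up ∷ X)
  b = h ≤ᵇ k
  c = nondecreasingᵇ (k ∷ valleysFrom k (up ∷ X))
  step : nondecreasingDyckFrom h (replicate (suc d) up ++ replicate (suc e) down ++ up ∷ X) ≡ a ∧ (b ∧ c)
  step = trans (nondecreasingDyckFrom-ascent h (suc d) (suc e) (up ∷ X))
               (cong₂ (λ b vs → b ∧ nondecreasingᵇ (h ∷ vs))
                      (dyckFrom-downs (up ∷ X) (s≤s e≤d+h))
                      (valleysFrom-downs-up X e≤d+h))

nondecreasingDyckFrom⇔Admissible : ∀ h m ms → All IsMountain (m ∷ ms) →
  T (nondecreasingDyckFrom h (fromMountains (m ∷ ms))) ⇔ Admissible h (m ∷ ms)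
nondecreasingDyckFrom⇔Admissible h (zero , _) _ ((() , _) ∷ _)
nondecreasingDyckFrom⇔Admissible h (_ , zero) _ ((_ , ()) ∷ _)
nondecreasingDyckFrom⇔Admissible h _ ((zero , _) ∷ _) (_ ∷ (() , _) ∷ _)
nondecreasingDyckFrom⇔Admissible h (suc d , suc e) [] _ =
  ⇔.trans (nondecreasingDyckFrom-lastMountain h d e)
          (mk⇔ (last ∘ cong suc) (λ { (last eq) → suc-injective eq }))
nondecreasingDyckFrom⇔Admissible h (suc d , suc e) ((suc d′ , e′) ∷ ms) (_ ∷ pos) =
  ⇔.trans (nondecreasingDyckFrom-mountain h d e _)
          (mk⇔ (λ (e≤d , t) → s≤s e≤d ∷ Equivalence.to rest⇔ t)
               (λ { (s≤s e≤d ∷ adm) → e≤d , Equivalence.from rest⇔ adm }))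
  where
  rest⇔ : T (nondecreasingDyckFrom (d + h ∸ e) (fromMountains ((suc d′ , e′) ∷ ms)))
          ⇔ Admissible (d + h ∸ e) ((suc d′ , e′) ∷ ms)
  rest⇔ = nondecreasingDyckFrom⇔Admissible (d + h ∸ e) (suc d′ , e′) ms pos

-- Reading a mountain sequence from its end

Rising : Mountain → Set
Rising (d , e) = e ≤ d

ascent climb : List Mountain → ℕ
ascent = sum ∘ map proj₁
climb  = sum ∘ map (λ (d , e) → d ∸ e)

sum-map-reverse : ∀ (f : Mountain → ℕ) ms → sum (map f (reverse ms)) ≡ sum (map f ms)
sum-map-reverse f ms = trans (cong sum (reverse-map f ms)) (sum-↭ (↭-reverse (map f ms)))

All-reverse⁻ : ∀ {P : Mountain → Set} {ms} → All P (reverse ms) → All P ms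
All-reverse⁻ {ms = ms} = All-resp-↭ (↭-reverse ms)

admissible-snoc : ∀ h xs {d e} →
  Admissible h (xs ++ (d , e) ∷ []) ⇔ (All Rising xs × e ≡ d + (h + climb xs))
admissible-snoc h xs {d} {e} = mk⇔ (to h xs) (from h xs)
  where
  shift : ∀ {a b} h c → b ≤ a → a + h ∸ b + c ≡ h + (a ∸ b + c)
  shift {a} {b} h c b≤a = begin
    a + h ∸ b + c   ≡⟨ cong (_+ c) (+-∸-comm h b≤a) ⟩
    a ∸ b + h + c   ≡⟨ cong (_+ c) (+-comm (a ∸ b) h) ⟩
    h + (a ∸ b) + c ≡⟨ +-assoc h (a ∸ b) c ⟩
    h + (a ∸ b + c) ∎
    where open ≡-Reasoning
  extend : ∀ {a b} h xs → b ≤ a → All Rising xs × e ≡ d + (a + h ∸ b + climb xs) →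
           All Rising ((a , b) ∷ xs) × e ≡ d + (h + climb ((a , b) ∷ xs))
  extend h xs b≤a (rs , eq) = b≤a ∷ rs , trans eq (cong (d +_) (shift h (climb xs) b≤a))
  to : ∀ h xs → Admissible h (xs ++ (d , e) ∷ []) → All Rising xs × e ≡ d + (h + climb xs)
  to h [] (last eq) = [] , trans eq (cong (d +_) (sym (+-identityʳ h)))
  to h [] (_ ∷ ())
  to h ((a , b) ∷ [])     (b≤a ∷ adm) = extend h [] b≤a (to _ [] adm)
  to h ((a , b) ∷ x ∷ xs) (b≤a ∷ adm) = extend h (x ∷ xs) b≤a (to _ (x ∷ xs) adm)
  from : ∀ h xs → All Rising xs × e ≡ d + (h + climb xs) → Admissible h (xs ++ (d , e) ∷ [])
  from h [] ([] , eq) = last (trans eq (cong (d +_) (+-identityʳ h)))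
  from h ((a , b) ∷ xs) (b≤a ∷ rs , eq) =
    b≤a ∷ from (a + h ∸ b) xs (rs , trans eq (cong (d +_) (sym (shift h (climb xs) b≤a))))

length-mountain : ∀ d e X → length (replicate d up ++ replicate e down ++ X) ≡ d + (e + length X)
length-mountain d e X = begin
  length (replicate d up ++ replicate e down ++ X)   ≡⟨ length-++ (replicate d up) ⟩
  length (replicate d up) + length (replicate e down ++ X)
    ≡⟨ cong₂ _+_ (length-replicate d) (trans (length-++ (replicate e down)) (cong (_+ length X) (length-replicate e))) ⟩
  d + (e + length X) ∎
  where open ≡-Reasoning

length-fromMountains : ∀ {h ms} → Admissible h ms → length (fromMountains ms) ≡ 2 * ascent ms + h
length-fromMountains {h} (last {d = d} refl) =
  trans (length-mountain d (d + h) []) (lastMountain d h)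
  where
  lastMountain : ∀ d h → d + (d + h + 0) ≡ 2 * (d + 0) + h
  lastMountain = solve-∀
length-fromMountains {h} (_∷_ {d = d} {e} {ms} e≤d adm) = begin
  length (fromMountains ((d , e) ∷ ms))     ≡⟨ length-mountain d e (fromMountains ms) ⟩
  d + (e + length (fromMountains ms))       ≡⟨ cong (λ l → d + (e + l)) (length-fromMountains adm) ⟩
  d + (e + (2 * ascent ms + (d + h ∸ e)))   ≡⟨ regroup d e (ascent ms) (d + h ∸ e) ⟩
  (e + (d + h ∸ e)) + (d + 2 * ascent ms)
    ≡⟨ cong (_+ (d + 2 * ascent ms)) (m+[n∸m]≡n (≤-trans e≤d (m≤m+n d h))) ⟩
  (d + h) + (d + 2 * ascent ms)             ≡⟨ regroup′ d h (ascent ms) ⟩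
  2 * (d + ascent ms) + h ∎
  where
  open ≡-Reasoning
  regroup : ∀ d e u k → d + (e + (2 * u + k)) ≡ (e + k) + (d + 2 * u)
  regroup = solve-∀
  regroup′ : ∀ d h u → (d + h) + (d + 2 * u) ≡ 2 * (d + u) + h
  regroup′ = solve-∀

-- A nondecreasing Dyck path of semilength N: the height of its last mountain, whose descent is then
-- forced, and the mountains before it, latest first.
record Config (N : ℕ) : Set where
  constructor config
  field
    prefix           : List Mountain
    top              : ℕ
    prefix-mountains : All IsMountain prefix
    prefix-rising    : All Rising prefix
    top-positive     : 1 ≤ top
    size             : top + ascent prefix ≡ N

open Config

-- The reversed mountain sequence, as in the definitions of A, B and C; the last mountain
-- descends from altitude top + climb prefix to 0.
shape : ∀ {N} → Config N → List Mountain
shape c = (top c , top c + climb (prefix c)) ∷ prefix c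

configPath : ∀ {N} → Config N → Path
configPath c = fromMountains (reverse (shape c))

config-≡ : ∀ {N} {c c′ : Config N} → prefix c ≡ prefix c′ → top c ≡ top c′ → c ≡ c′
config-≡ {c = config ps t m r p s} {config .ps .t m′ r′ p′ s′} refl refl
  rewrite All.irrelevant (λ (a , b) (a′ , b′) → cong₂ _,_ (≤-irrelevant a a′) (≤-irrelevant b b′)) m m′
        | All.irrelevant ≤-irrelevant r r′ | ≤-irrelevant p p′ | ≡-irrelevant s s′ = refl

shape-injective : ∀ {N} {c c′ : Config N} → shape c ≡ shape c′ → c ≡ c′
shape-injective eq with ∷-injective eq
... | top≡ , prefix≡ = config-≡ prefix≡ (cong proj₁ top≡)

All-reverse⁺ : ∀ {P : Mountain → Set} {ms} → All P ms → All P (reverse ms)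
All-reverse⁺ {ms = ms} = All-resp-↭ (↭-sym (↭-reverse ms))

config-admissible : ∀ {N} (c : Config N) →
  All IsMountain (reverse (shape c)) × Admissible 0 (reverse (shape c)) × ascent (reverse (shape c)) ≡ N
config-admissible c@(config ps t m r t≥1 s) =
  All-reverse⁺ ((t≥1 , ≤-trans t≥1 (m≤m+n t (climb ps))) ∷ m) ,
  subst (Admissible 0) (sym (unfold-reverse _ ps))
        (Equivalence.from (admissible-snoc 0 (reverse ps)) (All-reverse⁺ r , cong (t +_) (sym (sum-map-reverse _ ps)))) ,
  trans (sum-map-reverse proj₁ (shape c)) s

admissible-config : ∀ {N ms} → All IsMountain ms → Admissible 0 ms → ascent ms ≡ N →
  Σ (Config N) λ c → shape c ≡ reverse ms
admissible-config {N} {ms} pos adm size with reverse ms in eq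
... | [] = ⊥-elim (case subst (Admissible 0) (trans (sym (reverse-involutive ms)) (cong reverse eq)) adm of λ ())
... | (d , e) ∷ rr =
  config rr d (proj₂ last-and-prefix) (All-reverse⁻ (proj₁ snoc)) (proj₁ (proj₁ last-and-prefix))
         (trans (sym (sum-map-reverse proj₁ ((d , e) ∷ rr))) (trans (cong ascent (sym ms≡)) size)) ,
  cong (λ e → (d , e) ∷ rr) (sym (trans (proj₂ snoc) (cong (d +_) (sum-map-reverse _ rr))))
  where
  ms≡ : ms ≡ reverse ((d , e) ∷ rr)
  ms≡ = trans (sym (reverse-involutive ms)) (cong reverse eq)
  snoc : All Rising (reverse rr) × e ≡ d + (0 + climb (reverse rr))
  snoc = Equivalence.to (admissible-snoc 0 (reverse rr))
                        (subst (Admissible 0) (trans ms≡ (unfold-reverse (d , e) rr)) adm)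
  last-and-prefix : IsMountain (d , e) × All IsMountain rr
  last-and-prefix = All.uncons (All-reverse⁻ (subst (All IsMountain) ms≡ pos))

fromMountains-mountains : ∀ p → T (isDyck p) → All IsMountain (mountains p) × fromMountains (mountains p) ≡ p
fromMountains-mountains p dyck with dyck⇒fromMountains p dyck
... | ms , pos , refl = subst (All IsMountain) (sym (mountains-fromMountains pos)) pos ,
                        cong fromMountains (mountains-fromMountains pos)

nondecreasingDyckFrom-0 : ∀ p → nondecreasingDyckFrom 0 p ≡ isDyck p ∧ nondecreasingᵇ (valleys p)
nondecreasingDyckFrom-0 p = cong (isDyck p ∧_) (lowerBound-0 (valleys p))
  where
  lowerBound-0 : ∀ vs → nondecreasingᵇ (0 ∷ vs) ≡ nondecreasingᵇ vs
  lowerBound-0 []      = refl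
  lowerBound-0 (_ ∷ _) = refl

admissible⇒nondecreasingDyck : ∀ {h ms} → All IsMountain ms → Admissible h ms →
  T (nondecreasingDyckFrom h (fromMountains ms))
admissible⇒nondecreasingDyck {ms = []} _ ()
admissible⇒nondecreasingDyck {h} {m ∷ ms} pos adm =
  Equivalence.from (nondecreasingDyckFrom⇔Admissible h m ms pos) adm

inS⇒length : ∀ {N} p → T (inS N p) → length p ≡ 2 * N
inS⇒length {N} p t = ≡ᵇ⇒≡ (length p) (2 * N) (proj₁ (Equivalence.to (T-∧ {length p ≡ᵇ 2 * N}) t))

inS⇒isDyck : ∀ {N} p → T (inS N p) → T (isDyck p)
inS⇒isDyck {N} p t = proj₁ (Equivalence.to (T-∧ {isDyck p}) (proj₂ (Equivalence.to (T-∧ {length p ≡ᵇ 2 * N}) t)))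

inS-fromMountains : ∀ {N ms} → All IsMountain ms → Admissible 0 ms → ascent ms ≡ N →
  T (inS N (fromMountains ms))
inS-fromMountains {N} {ms} pos adm size = Equivalence.from T-∧
  ( ≡⇒≡ᵇ _ _ (trans (length-fromMountains adm) (trans (+-identityʳ _) (cong (2 *_) size)))
  , subst T (nondecreasingDyckFrom-0 (fromMountains ms)) (admissible⇒nondecreasingDyck pos adm))

inS-fromMountains⁻ : ∀ {N} ms → All IsMountain ms → T (inS (suc N) (fromMountains ms)) →
  Admissible 0 ms × ascent ms ≡ suc N
inS-fromMountains⁻ [] _ ()
inS-fromMountains⁻ {N} (m ∷ ms) pos t =
  adm , *-cancelˡ-≡ _ _ 2 (trans (sym (trans (length-fromMountains adm) (+-identityʳ _)))
                                 (inS⇒length {suc N} p t))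
  where
  p : Path
  p = fromMountains (m ∷ ms)
  adm : Admissible 0 (m ∷ ms)
  adm = Equivalence.to (nondecreasingDyckFrom⇔Admissible 0 m ms pos)
          (subst T (sym (nondecreasingDyckFrom-0 p)) (proj₂ (Equivalence.to (T-∧ {length p ≡ᵇ _}) t)))

pathConfig : ∀ {N} p → T (inS (suc N) p) → Σ (Config (suc N)) λ c → shape c ≡ reverse (mountains p)
pathConfig {N} p t = uncurry (admissible-config pos) shape-facts
  where
  dyck : T (isDyck p)
  dyck = inS⇒isDyck {suc N} p t
  pos : All IsMountain (mountains p)
  pos = proj₁ (fromMountains-mountains p dyck)
  shape-facts : Admissible 0 (mountains p) × ascent (mountains p) ≡ suc N
  shape-facts = inS-fromMountains⁻ (mountains p) pos
                   (subst (T ∘ inS (suc N)) (sym (proj₂ (fromMountains-mountains p dyck))) t)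

ConfigsWith : (List Mountain → Bool) → ℕ → Set
ConfigsWith Q N = Σ (Config N) λ c → T (Q (shape c))

configsWith-≡ : ∀ Q {N} {x y : ConfigsWith Q N} → proj₁ x ≡ proj₁ y → x ≡ y
configsWith-≡ Q {x = c , q} {.c , q′} refl = cong (c ,_) (T-irrelevant q q′)

configPath-inS : ∀ {N} (c : Config N) → T (inS N (configPath c))
configPath-inS c = let (pos , adm , size) = config-admissible c in inS-fromMountains pos adm size

mountains-configPath : ∀ {N} (c : Config N) → reverse (mountains (configPath c)) ≡ shape c
mountains-configPath c =
  trans (cong reverse (mountains-fromMountains (proj₁ (config-admissible c)))) (reverse-involutive (shape c))

paths↔configs : ∀ {N} (P : Path → Bool) (Q : List Mountain → Bool) →
  (∀ p → P p ≡ inS (suc N) p ∧ Q (reverse (mountains p))) →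
  Paths P (2 * suc N) ↔ ConfigsWith Q (suc N)
paths↔configs {N} P Q P≡ = mk↔ₛ′ to from to∘from from∘to
  where
  split : ∀ p → T (P p) → T (inS (suc N) p) × T (Q (reverse (mountains p)))
  split p t = Equivalence.to (T-∧ {inS (suc N) p}) (subst T (P≡ p) t)
  to : Paths P (2 * suc N) → ConfigsWith Q (suc N)
  to (p , _ , t) = let (c , shape≡) = pathConfig p (proj₁ (split p t))
                   in c , subst (T ∘ Q) (sym shape≡) (proj₂ (split p t))
  from : ConfigsWith Q (suc N) → Paths P (2 * suc N)
  from (c , q) = configPath c , inS⇒length {suc N} (configPath c) (configPath-inS c) ,
    subst T (sym (P≡ (configPath c)))
          (Equivalence.from T-∧ (configPath-inS c , subst (T ∘ Q) (sym (mountains-configPath c)) q))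
  to∘from : ∀ y → to (from y) ≡ y
  to∘from (c , _) = configsWith-≡ Q (shape-injective (trans (proj₂ (pathConfig (configPath c) _)) (mountains-configPath c)))
  from∘to : ∀ x → from (to x) ≡ x
  from∘to (p , _ , t) = Paths-≡ (begin
    fromMountains (reverse (shape c))               ≡⟨ cong (fromMountains ∘ reverse) shape≡ ⟩
    fromMountains (reverse (reverse (mountains p))) ≡⟨ cong fromMountains (reverse-involutive (mountains p)) ⟩
    fromMountains (mountains p)                     ≡⟨ proj₂ (fromMountains-mountains p (inS⇒isDyck {suc N} p inS-p)) ⟩
    p ∎)
    where
    open ≡-Reasoning
    inS-p : T (inS (suc N) p)
    inS-p = proj₁ (split p t)
    c : Config (suc N)
    c = proj₁ (pathConfig p inS-p)
    shape≡ : shape c ≡ reverse (mountains p)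
    shape≡ = proj₂ (pathConfig p inS-p)

-- Removing the peak of the last mountain.
A-configs↔S-configs : ∀ N → ConfigsWith lastTwoᵇ-A (suc N) ↔ ConfigsWith (const true) N
A-configs↔S-configs N = mk↔ₛ′ to from to∘from from∘to
  where
  to : ConfigsWith lastTwoᵇ-A (suc N) → ConfigsWith (const true) N
  to (config ps (suc zero)    m r _ s , ())
  to (config ps (suc (suc t)) m r _ s , _) = config ps (suc t) m r (s≤s z≤n) (suc-injective s) , tt
  from : ConfigsWith (const true) N → ConfigsWith lastTwoᵇ-A (suc N)
  from (config ps t m r t≥1 s , _) = config ps (suc t) m r (s≤s z≤n) (cong suc s) , ≤⇒≤ᵇ (s≤s t≥1)
  to∘from : ∀ y → to (from y) ≡ y
  to∘from (config ps (suc t) m r (s≤s z≤n) s , _) = configsWith-≡ (const true) (config-≡ refl refl)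
  from∘to : ∀ x → from (to x) ≡ x
  from∘to (config ps (suc zero)    m r _ s , ())
  from∘to (config ps (suc (suc t)) m r _ s , _) = configsWith-≡ lastTwoᵇ-A (config-≡ refl refl)

-- The last two mountains (a , a) and (1 , _) merge into a single mountain of height a.
B-configs↔S-configs : ∀ N → ConfigsWith lastTwoᵇ-B (suc N) ↔ ConfigsWith (const true) N
B-configs↔S-configs N = mk↔ₛ′ to from to∘from from∘to
  where
  to : ConfigsWith lastTwoᵇ-B (suc N) → ConfigsWith (const true) N
  to (config ((a , b) ∷ ps) (suc zero) ((a≥1 , _) ∷ m) (_ ∷ r) _ s , _) =
    config ps a m r a≥1 (suc-injective s) , tt
  to (config ((a , b) ∷ ps) (suc (suc t)) _ _ _ _ , q) = ⊥-elim (T-∧-false (a ≡ᵇ b) q)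
  from : ConfigsWith (const true) N → ConfigsWith lastTwoᵇ-B (suc N)
  from (config ps a m r a≥1 s , _) =
    config ((a , a) ∷ ps) 1 ((a≥1 , a≥1) ∷ m) (≤-refl ∷ r) (s≤s z≤n) (cong suc s) ,
    Equivalence.from T-∧ (≡⇒≡ᵇ a a refl , tt)
  to∘from : ∀ y → to (from y) ≡ y
  to∘from _ = configsWith-≡ (const true) (config-≡ refl refl)
  from∘to : ∀ x → from (to x) ≡ x
  from∘to (config ((a , b) ∷ ps) (suc zero) (_ ∷ _) (_ ∷ _) _ _ , q) =
    configsWith-≡ lastTwoᵇ-B (config-≡ (cong (λ b → (a , b) ∷ ps) a≡b) refl)
    where
    a≡b : a ≡ b
    a≡b = ≡ᵇ⇒≡ a b (proj₁ (Equivalence.to (T-∧ {a ≡ᵇ b}) q))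
  from∘to (config ((a , b) ∷ ps) (suc (suc t)) _ _ _ _ , q) = ⊥-elim (T-∧-false (a ≡ᵇ b) q)

lastTwo-B∨C⇔rising : ∀ e {a b} ms →
  T (lastTwoᵇ-B ((1 , e) ∷ (a , b) ∷ ms) ∨ lastTwoᵇ-C ((1 , e) ∷ (a , b) ∷ ms)) ⇔ b ≤ a
lastTwo-B∨C⇔rising _ {a} {b} _ = mk⇔
  ([ viaB , viaC ] ∘ Equivalence.to (T-∨ {(a ≡ᵇ b) ∧ true}))
  (Equivalence.from (T-∨ {(a ≡ᵇ b) ∧ true}) ∘ [ toC , toB ] ∘ m≤n⇒m<n∨m≡n)
  where
  viaB : T ((a ≡ᵇ b) ∧ true) → b ≤ a
  viaB qB = ≤-reflexive (sym (≡ᵇ⇒≡ a b (proj₁ (Equivalence.to (T-∧ {a ≡ᵇ b}) qB))))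
  viaC : T ((suc b ≤ᵇ a) ∧ true) → b ≤ a
  viaC qC = <⇒≤ (≤ᵇ⇒≤ (suc b) a (proj₁ (Equivalence.to (T-∧ {suc b ≤ᵇ a}) qC)))
  toB : b ≡ a → T ((a ≡ᵇ b) ∧ true) ⊎ T ((suc b ≤ᵇ a) ∧ true)
  toB b≡a = inj₁ (Equivalence.from T-∧ (≡⇒≡ᵇ a b (sym b≡a) , tt))
  toC : b < a → T ((a ≡ᵇ b) ∧ true) ⊎ T ((suc b ≤ᵇ a) ∧ true)
  toC b<a = inj₂ (Equivalence.from T-∧ (≤⇒≤ᵇ b<a , tt))

-- Lowering the peak of the penultimate mountain by one step.
C-configs↔B∨C-configs : ∀ N →
  ConfigsWith lastTwoᵇ-C (suc N) ↔ ConfigsWith (λ s → lastTwoᵇ-B s ∨ lastTwoᵇ-C s) N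
C-configs↔B∨C-configs N = mk↔ₛ′ to from to∘from from∘to
  where
  B∨C : List Mountain → Bool
  B∨C s = lastTwoᵇ-B s ∨ lastTwoᵇ-C s
  notHigher : ∀ a b → ¬ T (((a ≡ᵇ b) ∧ false) ∨ ((suc b ≤ᵇ a) ∧ false))
  notHigher a b q =
    [ T-∧-false (a ≡ᵇ b) , T-∧-false (suc b ≤ᵇ a) ] (Equivalence.to (T-∨ {(a ≡ᵇ b) ∧ false}) q)
  to : ConfigsWith lastTwoᵇ-C (suc N) → ConfigsWith B∨C N
  to (config ((suc a , b) ∷ ps) (suc zero) ((_ , b≥1) ∷ m) (_ ∷ r) _ s , q) =
    config ((a , b) ∷ ps) 1 ((≤-trans b≥1 b≤a , b≥1) ∷ m) (b≤a ∷ r) (s≤s z≤n) (suc-injective s) ,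
    Equivalence.from (lastTwo-B∨C⇔rising (1 + climb ((a , b) ∷ ps)) ps) b≤a
    where
    b≤a : b ≤ a
    b≤a = ≤-pred (≤ᵇ⇒≤ (suc b) (suc a) (proj₁ (Equivalence.to (T-∧ {suc b ≤ᵇ suc a}) q)))
  to (config ((a , b) ∷ ps) (suc (suc t)) _ _ _ _ , q) = ⊥-elim (T-∧-false (suc b ≤ᵇ a) q)
  from : ConfigsWith B∨C N → ConfigsWith lastTwoᵇ-C (suc N)
  from (config ((a , b) ∷ ps) (suc zero) ((_ , b≥1) ∷ m) (_ ∷ r) _ s , q) =
    config ((suc a , b) ∷ ps) 1 ((s≤s z≤n , b≥1) ∷ m) (m≤n⇒m≤1+n b≤a ∷ r) (s≤s z≤n) (cong suc s) ,
    Equivalence.from T-∧ (≤⇒≤ᵇ (s≤s b≤a) , tt)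
    where
    b≤a : b ≤ a
    b≤a = Equivalence.to (lastTwo-B∨C⇔rising (1 + climb ((a , b) ∷ ps)) ps) q
  from (config ((a , b) ∷ _) (suc (suc t)) _ _ _ _ , q) = ⊥-elim (notHigher a b q)
  to∘from : ∀ y → to (from y) ≡ y
  to∘from (config (_ ∷ _) (suc zero) (_ ∷ _) (_ ∷ _) _ _ , _) = configsWith-≡ B∨C (config-≡ refl refl)
  to∘from (config ((a , b) ∷ _) (suc (suc t)) _ _ _ _ , q) = ⊥-elim (notHigher a b q)
  from∘to : ∀ x → from (to x) ≡ x
  from∘to (config ((suc a , b) ∷ ps) (suc zero) (_ ∷ _) (_ ∷ _) _ _ , _) =
    configsWith-≡ lastTwoᵇ-C (config-≡ refl refl)
  from∘to (config ((a , b) ∷ ps) (suc (suc t)) _ _ _ _ , q) = ⊥-elim (T-∧-false (suc b ≤ᵇ a) q)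

lastTwo-B-C-disjoint : ∀ ms → T (lastTwoᵇ-B ms) → T (lastTwoᵇ-C ms) → ⊥
lastTwo-B-C-disjoint ((_ , _) ∷ (a , b) ∷ _) qB qC =
  <-irrefl (sym (≡ᵇ⇒≡ a b (proj₁ (Equivalence.to (T-∧ {a ≡ᵇ b}) qB))))
           (≤ᵇ⇒≤ (suc b) a (proj₁ (Equivalence.to (T-∧ {suc b ≤ᵇ a}) qC)))

mainTheorem12 : (n : ℕ) → 2 ≤ n →
    (∣A∣ n ≡ ∣S∣ (n ∸ 1)) × (∣B∣ n ≡ ∣S∣ (n ∸ 1)) × (∣C∣ n ≡ ∣B∣ (n ∸ 1) + ∣C∣ (n ∸ 1))
mainTheorem12 _ (s≤s (s≤s {n = k} _)) =
  count-cong (↔-trans (paths↔ lastTwoᵇ-A) (↔-trans (A-configs↔S-configs (suc k)) (↔-sym S↔))) ,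
  count-cong (↔-trans (paths↔ lastTwoᵇ-B) (↔-trans (B-configs↔S-configs (suc k)) (↔-sym S↔))) ,
  count-cong-⊎ (↔-trans (paths↔ lastTwoᵇ-C) (↔-trans (C-configs↔B∨C-configs (suc k)) (↔-trans B∨C↔
                 (↔-sym (paths↔ lastTwoᵇ-B) ⊎-↔ ↔-sym (paths↔ lastTwoᵇ-C)))))
  where
  paths↔ : ∀ {N} Q → Paths (λ p → inS (suc N) p ∧ Q (reverse (mountains p))) (2 * suc N) ↔ ConfigsWith Q (suc N)
  paths↔ Q = paths↔configs _ Q (λ _ → refl)
  S↔ : Paths (inS (suc k)) (2 * suc k) ↔ ConfigsWith (const true) (suc k)
  S↔ = paths↔configs (inS (suc k)) (const true) (λ p → sym (∧-identityʳ (inS (suc k) p)))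
  B∨C↔ : ConfigsWith (λ s → lastTwoᵇ-B s ∨ lastTwoᵇ-C s) (suc k)
         ↔ (ConfigsWith lastTwoᵇ-B (suc k) ⊎ ConfigsWith lastTwoᵇ-C (suc k))
  B∨C↔ = Σ-T-∨↔⊎ (lastTwoᵇ-B ∘ shape) (lastTwoᵇ-C ∘ shape) (lastTwo-B-C-disjoint ∘ shape)
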